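{- Let $F$ be a tract, $\sigma\in\{0,1\}$, and let $\varphi:\mathcal T_n\cup\mathcal A_n\to F$ satisfy: for all $B\in\mathcal T_n^\sigma$ and distinct $i,j\in[n]$, $\varphi((B\setminus\{i,i^*\})\cup\{j,j^*\})=(-1)^{[i\in B]+[j\in B]}\varphi((B\cup\{i,i^*\})\setminus\{j,j^*\})$. Let $A\in\mathcal A_n$ and let $i,j$ be such that $\{i,i^*\}\cap A=\emptyset$ and $\{j,j^*\}\subseteq A$. Then $\varphi(A)=(-1)^{|A\cap[n]^*|+1-\sigma}\varphi((A\cup\{i,i^*\})\setminus\{j,j^*\})$.
   Context: A tract $F$ is a multiplicative monoid $F^\times\sqcup\{0\}$ ($F^\times$ an abelian group) with a null set $N_F$ of formal sums such that there is a unique $-1\in F^\times$ with $1+(-1)\in N_F$ (plus standard axioms); $(-1)^k$ denotes the corresponding power. $[n]^*=\{1^*,\dots,n^*\}$, $(i^*)^*=i$. $[P]$ is the indicator of $P$. $\mathcal T_n$: transversals of $[n]\cup[n]^*$ (sets containing exactly one of $i,i^*$ for each $i\in[n]$); $\mathcal T_n^\sigma$: those with $|T\cap[n]^*|\equiv\sigma\pmod 2$; $\mathcal A_n$: $n$-subsets of $[n]\cup[n]^*$ containing exactly one pair $\{k,k^*\}$. -}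

module Defs where

open import Data.Nat using (ℕ; zero; suc; _+_)
open import Data.Fin using (Fin)
open import Data.Bool using (Bool; true; false; _xor_; _∧_)
open import Data.Product using (_×_; _,_; proj₁; proj₂; ∃)
open import Data.List using (List; []; _∷_; map)
open import Data.List.Relation.Binary.Permutation.Propositional using (_↭_)
open import Data.Maybe using (Maybe; just; nothing)
open import Data.Vec using (Vec; lookup; _[_]≔_; foldr)
open import Relation.Nullary using (¬_)
open import Relation.Binary.PropositionalEquality using (_≡_)
open import Algebra.Structures using (IsAbelianGroup)

-- F^× is an abelian group `Unit`; F = F^× ⊔ {0}
-- is modelled as `Maybe Unit` (nothing = 0).  Formal sums of elements of
-- F^× (elements of ℕ[F^×]) are lists up to permutation; the null set N_F
-- is a permutation-invariant predicate on lists.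

record Tract : Set₁ where
  field
    Unit      : Set
    _·_       : Unit → Unit → Unit
    one       : Unit
    inv       : Unit → Unit
    isAbGroup : IsAbelianGroup _≡_ _·_ one inv
    N         : List Unit → Set
    N-perm    : ∀ {xs ys} → xs ↭ ys → N xs → N ys
    N-zero    : N []
    N-one     : ¬ N (one ∷ [])
    minus-one : Unit
    N-neg     : N (one ∷ minus-one ∷ [])
    neg-uniq  : ∀ e → N (one ∷ e ∷ []) → e ≡ minus-one
    N-mul     : ∀ a xs → N xs → N (map (a ·_) xs)

  F : Set
  F = Maybe Unit

  upow : Unit → ℕ → Unit
  upow u zero    = one
  upow u (suc k) = u · upow u k

  sgn : ℕ → F
  sgn k = just (upow minus-one k)

  _*F_ : F → F → F
  just a *F just b = just (a · b)
  _ *F _ = nothing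

-- Subsets of [n] ∪ [n]*.  A subset S is encoded canonically as a vector
-- whose k-th entry is (k ∈ S , k* ∈ S).

Sub : ℕ → Set
Sub n = Vec (Bool × Bool) n

[_] : Bool → ℕ
[ true ]  = 1
[ false ] = 0

card : ∀ {n} → Sub n → ℕ
card = foldr _ (λ p acc → [ proj₁ p ] + [ proj₂ p ] + acc) 0

starCount : ∀ {n} → Sub n → ℕ
starCount = foldr _ (λ p acc → [ proj₂ p ] + acc) 0

IsTransversal : ∀ {n} → Sub n → Set
IsTransversal S = ∀ k → (proj₁ (lookup S k) xor proj₂ (lookup S k)) ≡ true

IsTransversalσ : ∀ {n} → ℕ → Sub n → Set
IsTransversalσ σ S = IsTransversal S × (starCount S Data.Nat.% 2 ≡ σ)
  where import Data.Nat

HasPair : ∀ {n} → Sub n → Fin n → Set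
HasPair S k = (proj₁ (lookup S k) ∧ proj₂ (lookup S k)) ≡ true

IsA : ∀ {n} → Sub n → Set
IsA {n} S = card S ≡ n × ∃ λ k → HasPair S k × (∀ k' → HasPair S k' → k' ≡ k)

swapIn : ∀ {n} → Sub n → Fin n → Fin n → Sub n
swapIn S i j = (S [ i ]≔ (false , false)) [ j ]≔ (true , true)

swapOut : ∀ {n} → Sub n → Fin n → Fin n → Sub n
swapOut S i j = (S [ i ]≔ (true , true)) [ j ]≔ (false , false)

{-# OPTIONS --safe #-}
-- Put i into A and keep only one of j, j*. As |A| = n while A misses i and contains no pair
-- but {j,j*}, every other index occurs exactly once in A, so the result B is a transversal;
-- moreover (B \ {i,i*}) ∪ {j,j*} = A and (B ∪ {i,i*}) \ {j,j*} = (A ∪ {i,i*}) \ {j,j*}.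
-- Keeping j* rather than j raises |B ∩ [n]*| by one, so one choice puts B in 𝒯^σ, and the
-- exchange relation for this B is the claim: its exponent [i ∈ B] + [j ∈ B] = 1 + [j ∈ B]
-- agrees with |A ∩ [n]*| + 1 - σ mod 2, which suffices since (-1)² = 1.
module Submission where

open import Defs
open import Algebra.Structures using (IsAbelianGroup)
open import Data.Bool using (Bool; true; false; not; _xor_; _∧_)
open import Data.Fin using (Fin; zero; suc; _≟_)
open import Data.List using ([]; _∷_)
open import Data.List.Relation.Binary.Permutation.Propositional using (↭-swap; ↭-refl)
open import Data.Maybe using (just)
open import Data.Nat using (ℕ; zero; suc; _+_; _∸_; _%_; _≤_; z≤n; s≤s)
open import Data.Nat.Properties
  using (+-assoc; +-identityʳ; +-cancelʳ-≡; +-comm; +-mono-≤; suc-injective; ≤-reflexive; n≮n; +-commutativeSemigroup)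
open import Algebra.Properties.CommutativeSemigroup +-commutativeSemigroup using (xy∙z≈zy∙x)
open import Data.Product using (_×_; _,_; proj₁; proj₂; ∃-syntax)
open import Data.Vec using (Vec; []; _∷_; lookup; foldr; _[_]≔_)
open import Data.Vec.Properties using (lookup∘update; lookup∘update′; []≔-idempotent; []≔-commutes; []≔-lookup)
open import Function using (_∘_)
open import Relation.Nullary using (yes; no; contradiction)
open import Relation.Binary.PropositionalEquality
  using (_≡_; _≢_; refl; sym; trans; cong; cong₂; subst; module ≡-Reasoning)

open ≡-Reasoning

private
  variable
    A : Set
    n : ℕ

module _ (T : Tract) where
  open Tract T
  open IsAbelianGroup isAbGroup using (assoc; identityˡ; identityʳ; inverseˡ; inverseʳ)

  -- Scaling the null sum 1 + (-1) by (-1)⁻¹ gives the null sum (-1)⁻¹ + 1.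
  inv-minus-one : inv minus-one ≡ minus-one
  inv-minus-one = neg-uniq (inv minus-one) (N-perm (↭-swap _ _ ↭-refl) scaled)
    where
    scaled : N (inv minus-one ∷ one ∷ [])
    scaled = subst N (cong₂ (λ a b → a ∷ b ∷ []) (identityʳ _) (inverseˡ _))
                     (N-mul (inv minus-one) _ N-neg)

  minus-one²≡one : minus-one · minus-one ≡ one
  minus-one²≡one = trans (cong (minus-one ·_) (sym inv-minus-one)) (inverseʳ minus-one)

  upow-minus-one-%2 : ∀ k → upow minus-one k ≡ upow minus-one (k % 2)
  upow-minus-one-%2 zero          = refl
  upow-minus-one-%2 (suc zero)    = refl
  upow-minus-one-%2 (suc (suc k)) = begin
    minus-one · (minus-one · upow minus-one k)  ≡⟨ sym (assoc _ _ _) ⟩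
    (minus-one · minus-one) · upow minus-one k  ≡⟨ cong (_· upow minus-one k) minus-one²≡one ⟩
    one · upow minus-one k                      ≡⟨ identityˡ _ ⟩
    upow minus-one k                            ≡⟨ upow-minus-one-%2 k ⟩
    upow minus-one (k % 2)                      ∎

  sgn-cong-%2 : ∀ a b → a % 2 ≡ b % 2 → sgn a ≡ sgn b
  sgn-cong-%2 a b a≡b = cong just (begin
    upow minus-one a        ≡⟨ upow-minus-one-%2 a ⟩
    upow minus-one (a % 2)  ≡⟨ cong (upow minus-one) a≡b ⟩
    upow minus-one (b % 2)  ≡⟨ upow-minus-one-%2 b ⟨
    upow minus-one b        ∎)

sumBy : (A → ℕ) → Vec A n → ℕ
sumBy f = foldr _ (λ x acc → f x + acc) 0

sumBy-[]≔ : ∀ (f : A → ℕ) (xs : Vec A n) {i x y} → lookup xs i ≡ y →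
            sumBy f (xs [ i ]≔ x) + f y ≡ sumBy f xs + f x
sumBy-[]≔ f (y ∷ xs) {zero}      refl = xy∙z≈zy∙x _ (sumBy f xs) (f y)
sumBy-[]≔ f (y ∷ xs) {suc i} {x} refl = begin
  f y + sumBy f (xs [ i ]≔ x) + f (lookup xs i)    ≡⟨ +-assoc (f y) _ _ ⟩
  f y + (sumBy f (xs [ i ]≔ x) + f (lookup xs i))  ≡⟨ cong (f y +_) (sumBy-[]≔ f xs refl) ⟩
  f y + (sumBy f xs + f x)                         ≡⟨ +-assoc (f y) _ _ ⟨
  f y + sumBy f xs + f x                           ∎

sumBy-≤ : ∀ (f : A → ℕ) (xs : Vec A n) → (∀ k → f (lookup xs k) ≤ 1) → sumBy f xs ≤ n
sumBy-≤ f []       bounded = z≤n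
sumBy-≤ f (x ∷ xs) bounded = +-mono-≤ (bounded zero) (sumBy-≤ f xs (bounded ∘ suc))

sumBy≡length⇒all≡1 : ∀ (f : A → ℕ) (xs : Vec A n) → (∀ k → f (lookup xs k) ≤ 1) →
                     sumBy f xs ≡ n → ∀ k → f (lookup xs k) ≡ 1
sumBy≡length⇒all≡1 f (x ∷ xs) bounded total k with f x in fx≡ | bounded zero
... | 0           | _       = contradiction (subst (_≤ _) total (sumBy-≤ f xs (bounded ∘ suc))) (n≮n _)
... | suc (suc _) | s≤s ()
... | 1           | _ with k
...   | zero  = fx≡
...   | suc k = sumBy≡length⇒all≡1 f xs (bounded ∘ suc) (suc-injective total) k

[]≔-[]≔-overwrite : ∀ (xs : Vec A n) {i j} → i ≢ j → ∀ {a b c d : A} →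
                    (((xs [ i ]≔ a) [ j ]≔ b) [ i ]≔ c) [ j ]≔ d ≡ (xs [ i ]≔ c) [ j ]≔ d
[]≔-[]≔-overwrite xs {i} {j} i≢j {a} {b} {c} {d} = begin
  (((xs [ i ]≔ a) [ j ]≔ b) [ i ]≔ c) [ j ]≔ d  ≡⟨ cong (_[ j ]≔ d) ([]≔-commutes (xs [ i ]≔ a) j i (i≢j ∘ sym)) ⟩
  (((xs [ i ]≔ a) [ i ]≔ c) [ j ]≔ b) [ j ]≔ d  ≡⟨ []≔-idempotent ((xs [ i ]≔ a) [ i ]≔ c) j ⟩
  ((xs [ i ]≔ a) [ i ]≔ c) [ j ]≔ d             ≡⟨ cong (_[ j ]≔ d) ([]≔-idempotent xs i) ⟩
  (xs [ i ]≔ c) [ j ]≔ d                        ∎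

weight : Bool × Bool → ℕ
weight p = [ proj₁ p ] + [ proj₂ p ]

weight-complement : ∀ c → weight (c , not c) ≡ 1
weight-complement true  = refl
weight-complement false = refl

weight≡1⇒xor : ∀ p → weight p ≡ 1 → proj₁ p xor proj₂ p ≡ true
weight≡1⇒xor (true  , false) _ = refl
weight≡1⇒xor (false , true)  _ = refl
weight≡1⇒xor (true  , true)  ()
weight≡1⇒xor (false , false) ()

¬pair⇒weight≤1 : ∀ p → proj₁ p ∧ proj₂ p ≢ true → weight p ≤ 1
¬pair⇒weight≤1 (true  , true)  ¬pair = contradiction refl ¬pair
¬pair⇒weight≤1 (true  , false) _     = s≤s z≤n
¬pair⇒weight≤1 (false , true)  _     = s≤s z≤n
¬pair⇒weight≤1 (false , false) _     = z≤n

parity-choice : ∀ t σ → σ ≤ 1 →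
                ∃[ c ] (t + [ not c ]) % 2 ≡ σ × (1 + [ c ]) % 2 ≡ (suc t + 1 ∸ σ) % 2
parity-choice 0             0             _      = true  , refl , refl
parity-choice 0             1             _      = false , refl , refl
parity-choice 1             0             _      = false , refl , refl
parity-choice 1             1             _      = true  , refl , refl
parity-choice (suc (suc t)) 0             σ≤1    = parity-choice t 0 σ≤1
parity-choice (suc (suc t)) 1             σ≤1    = parity-choice t 1 σ≤1
parity-choice _             (suc (suc _)) (s≤s ())

exchange : Sub n → Fin n → Fin n → Bool → Sub n
exchange S i j c = (S [ i ]≔ (true , false)) [ j ]≔ (c , not c)

lookup-exchange-other : ∀ (S : Sub n) {i j k} c → k ≢ i → k ≢ j →
                        lookup (exchange S i j c) k ≡ lookup S k
lookup-exchange-other S {i} c k≢i k≢j =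
  trans (lookup∘update′ k≢j (S [ i ]≔ (true , false)) (c , not c)) (lookup∘update′ k≢i S _)

starCount-exchange : ∀ (S : Sub n) i j c →
                     starCount (exchange S i j c) ≡ starCount (exchange S i j true) + [ not c ]
starCount-exchange S i j c = begin
  starCount (exchange S i j c)                            ≡⟨ +-identityʳ _ ⟨
  starCount (exchange S i j c) + 0                        ≡⟨ cong (λ V → starCount V + 0) ([]≔-idempotent S′ j) ⟨
  starCount (exchange S i j true [ j ]≔ (c , not c)) + 0
    ≡⟨ sumBy-[]≔ (λ p → [ proj₂ p ]) (exchange S i j true) (lookup∘update j S′ (true , false)) ⟩
  starCount (exchange S i j true) + [ not c ]             ∎
  where
  S′ : Sub _
  S′ = S [ i ]≔ (true , false)

module _ (S : Sub n) {i j : Fin n} (i≢j : i ≢ j) where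

  lookup-exchange-i : ∀ c → lookup (exchange S i j c) i ≡ (true , false)
  lookup-exchange-i c = trans (lookup∘update′ i≢j (S [ i ]≔ (true , false)) (c , not c)) (lookup∘update i S _)

  exchange-sign : ∀ c → [ proj₁ (lookup (exchange S i j c) i) ] + [ proj₁ (lookup (exchange S i j c) j) ]
                        ≡ 1 + [ c ]
  exchange-sign c = cong₂ (λ p q → [ proj₁ p ] + [ proj₁ q ])
                          (lookup-exchange-i c) (lookup∘update j (S [ i ]≔ (true , false)) (c , not c))

  swapOut-exchange : ∀ c → swapOut (exchange S i j c) i j ≡ swapOut S i j
  swapOut-exchange c = []≔-[]≔-overwrite S i≢j

module _ (S : Sub n) (i j : Fin n)
         (Si : lookup S i ≡ (false , false)) (Sj : lookup S j ≡ (true , true)) where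

  empty≢pair : i ≢ j
  empty≢pair refl with trans (sym Si) Sj
  ... | ()

  private
    S′ : Sub n
    S′ = S [ i ]≔ (true , false)

    S′j : lookup S′ j ≡ (true , true)
    S′j = trans (lookup∘update′ (empty≢pair ∘ sym) S _) Sj

  swapIn-exchange : ∀ c → swapIn (exchange S i j c) i j ≡ S
  swapIn-exchange c = begin
    swapIn (exchange S i j c) i j                    ≡⟨ []≔-[]≔-overwrite S empty≢pair ⟩
    (S [ i ]≔ (false , false)) [ j ]≔ (true , true)  ≡⟨ cong₂ (λ p q → (S [ i ]≔ p) [ j ]≔ q) Si Sj ⟨
    (S [ i ]≔ lookup S i) [ j ]≔ lookup S j          ≡⟨ cong (_[ j ]≔ lookup S j) ([]≔-lookup S i) ⟩
    S [ j ]≔ lookup S j                              ≡⟨ []≔-lookup S j ⟩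
    S                                                ∎

  card-exchange : ∀ c → card (exchange S i j c) ≡ card S
  card-exchange c = +-cancelʳ-≡ 2 _ _ (begin
    card (exchange S i j c) + 2  ≡⟨ sumBy-[]≔ weight S′ S′j ⟩
    card S′ + weight (c , not c) ≡⟨ cong (card S′ +_) (weight-complement c) ⟩
    card S′ + 1                  ≡⟨ cong (_+ 1) (+-identityʳ (card S′)) ⟨
    card S′ + 0 + 1              ≡⟨ cong (_+ 1) (sumBy-[]≔ weight S Si) ⟩
    card S + 1 + 1               ≡⟨ +-assoc (card S) 1 1 ⟩
    card S + 2                   ∎)

  starCount-exchange-true : starCount S ≡ suc (starCount (exchange S i j true))
  starCount-exchange-true = sym (begin
    suc (starCount (exchange S i j true))  ≡⟨ +-comm 1 _ ⟩
    starCount (exchange S i j true) + 1    ≡⟨ sumBy-[]≔ (λ p → [ proj₂ p ]) S′ S′j ⟩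
    starCount S′ + 0                       ≡⟨ sumBy-[]≔ (λ p → [ proj₂ p ]) S Si ⟩
    starCount S + 0                        ≡⟨ +-identityʳ _ ⟩
    starCount S                            ∎)

  exchange-isTransversal : IsA S → ∀ c → IsTransversal (exchange S i j c)
  exchange-isTransversal (card≡n , _ , _ , pair-unique) c k =
    weight≡1⇒xor (lookup B k) (sumBy≡length⇒all≡1 weight B bounded (trans (card-exchange c) card≡n) k)
    where
    B : Sub n
    B = exchange S i j c

    pairs-only-at-j : ∀ k → HasPair S k → k ≡ j
    pairs-only-at-j k pair =
      trans (pair-unique k pair) (sym (pair-unique j (cong (λ p → proj₁ p ∧ proj₂ p) Sj)))

    bounded : ∀ k → weight (lookup B k) ≤ 1
    bounded k with k ≟ j | k ≟ i
    ... | yes refl | _        = ≤-reflexive (trans (cong weight (lookup∘update j S′ _)) (weight-complement c))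
    ... | no _     | yes refl = ≤-reflexive (cong weight (lookup-exchange-i S empty≢pair c))
    ... | no k≢j   | no k≢i   = subst (λ p → weight p ≤ 1) (sym (lookup-exchange-other S c k≢i k≢j))
                                      (¬pair⇒weight≤1 (lookup S k) (k≢j ∘ pairs-only-at-j k))

  exchange-∈𝒯σ : ∀ {σ} → IsA S → σ ≤ 1 →
                 ∃[ c ] IsTransversalσ σ (exchange S i j c) × (1 + [ c ]) % 2 ≡ (starCount S + 1 ∸ σ) % 2
  exchange-∈𝒯σ {σ} S∈𝒜 σ≤1 with parity-choice (starCount (exchange S i j true)) σ σ≤1
  ... | c , star-parity , sign-parity =
    c , (exchange-isTransversal S∈𝒜 c , trans (cong (_% 2) (starCount-exchange S i j c)) star-parity)
      , subst (λ s → (1 + [ c ]) % 2 ≡ (s + 1 ∸ σ) % 2) (sym starCount-exchange-true) sign-parity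

lemma3p4 : (T : Tract) → let open Tract T in
    (n σ : ℕ) → σ ≤ 1 → (φ : Sub n → F) →
    (∀ (B : Sub n) → IsTransversalσ σ B → (i j : Fin n) → i ≢ j →
      φ (swapIn B i j) ≡ sgn ([ proj₁ (lookup B i) ] + [ proj₁ (lookup B j) ]) *F φ (swapOut B i j)) →
    (A : Sub n) → IsA A → (i j : Fin n) →
    lookup A i ≡ (false , false) → lookup A j ≡ (true , true) →
    φ A ≡ sgn (starCount A + 1 ∸ σ) *F φ (swapOut A i j)
lemma3p4 T n σ σ≤1 φ relation A A∈𝒜 i j Ai Aj with exchange-∈𝒯σ A i j Ai Aj A∈𝒜 σ≤1
... | c , B∈𝒯σ , parity = begin
  φ A                                             ≡⟨ cong φ (swapIn-exchange A i j Ai Aj c) ⟨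
  φ (swapIn B i j)                                ≡⟨ relation B B∈𝒯σ i j i≢j ⟩
  sgn ([ proj₁ (lookup B i) ] + [ proj₁ (lookup B j) ]) *F φ (swapOut B i j)
    ≡⟨ cong₂ _*F_ (cong sgn (exchange-sign A i≢j c)) (cong φ (swapOut-exchange A i≢j c)) ⟩
  sgn (1 + [ c ]) *F φ (swapOut A i j)
    ≡⟨ cong (_*F φ (swapOut A i j)) (sgn-cong-%2 T (1 + [ c ]) (starCount A + 1 ∸ σ) parity) ⟩
  sgn (starCount A + 1 ∸ σ) *F φ (swapOut A i j)  ∎
  where
  open Tract T

  B : Sub n
  B = exchange A i j c

  i≢j : i ≢ j
  i≢j = empty≢pair A i j Ai Aj
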